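{- Let $S$ be as in the context and suppose that $|\Pi_1|$ is even. Then the nontrivial orbits of $F_2^n$ under the group $\mathbf W_P$ (acting by left multiplication) are $\overline U_{\{1\}}$, $\overline U_{\{i+1,n+1-i\}}$ and $U_{\{i,n-i\}}$ for $1\le i\le\lfloor n/2\rfloor$.
   Context: $S$ is a finite simple connected graph with vertex set $\{s_1,\dots,s_n\}$, $n\ge2$, and edge set $R$, such that $s_1,\dots,s_{n-1}$ is an induced path; $s_n$ is adjacent to some of $s_1,\dots,s_{n-1}$. $\widetilde s$ is the characteristic vector in $F_2^n$ (coordinates indexed by vertices) of vertex $s$. The flipping move of $s$ is $\mathbf s\in\mathrm{Mat}_n(F_2)$ with $\mathbf s_{ab}=1$ if $a=b$, or if $b=s$ and $ab\in R$, and $0$ otherwise. $\mathbf W_P$ is the subgroup of $\mathrm{GL}_n(F_2)$ generated by $\mathbf{s_1},\dots,\mathbf{s_{n-1}}$. $\overline1=\widetilde s_1$ and $\overline{i+1}=\mathbf{s_i}\cdots\mathbf{s_1}\overline1$ for $1\le i\le n-1$; also $\overline{n+1}:=\widetilde s_n$. $\Pi=\{\overline1,\dots,\overline n\}$, $\Pi_0=\{\overline i\in\Pi:\langle\overline i,\widetilde s_n\rangle=0\}$, and $\Pi_1=\Pi\setminus\Pi_0$. $U=\mathrm{span}(\Pi)$ and $\overline U=F_2^n\setminus U$. When $|\Pi_1|$ is even, $\Delta=(\Pi\cup\{\overline{n+1}\})\setminus\{\overline n\}$, which is a basis of $F_2^n$. $sw(u)$ is the number of elements of $\Delta$ appearing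 in the expansion of $u$ in the basis $\Delta$. For $V\subseteq F_2^n$ and $T\subseteq\{0,\dots,n\}$, $V_T=\{u\in V: sw(u)\in T\}$. -}

module Defs where

open import Data.Bool using (Bool; true; false; _∧_; _∨_; _xor_; if_then_else_)
open import Data.Nat using (ℕ; zero; suc; _<_; _≤_; _+_; _≡ᵇ_; _<?_; _/_)
open import Data.Fin using (Fin; toℕ; fromℕ; fromℕ<; inject₁; _≟_)
open import Data.Vec using (Vec; tabulate; lookup; zipWith; replicate; foldr; map)
open import Data.List using (List; []; _∷_; filter; length; upTo)
open import Data.Product using (Σ; ∃; _×_; _,_)
open import Data.Sum using (_⊎_)
open import Relation.Nullary using (¬_; does)
open import Relation.Binary.PropositionalEquality using (_≡_)
open import Function.Bundles using (_⇔_)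

-- Linear algebra over F₂ = Bool (xor = +, ∧ = ·)

-- Vectors of F₂^N, coordinates indexed by the vertices Fin N
F2^ : ℕ → Set
F2^ N = Vec Bool N

Mat : ℕ → Set
Mat N = Fin N → Fin N → Bool

zeroV : ∀ {N} → F2^ N
zeroV = replicate _ false

_⊕_ : ∀ {N} → F2^ N → F2^ N → F2^ N
u ⊕ v = zipWith _xor_ u v

⟨_,_⟩ : ∀ {N} → F2^ N → F2^ N → Bool
⟨ u , v ⟩ = foldr _ _xor_ false (zipWith _∧_ u v)

_·_ : ∀ {N} → Mat N → F2^ N → F2^ N
M · v = tabulate (λ a → ⟨ tabulate (M a) , v ⟩)

chr : ∀ {N} → Fin N → F2^ N
chr s = tabulate (λ b → does (b ≟ s))

lincomb : ∀ {N m} → Vec Bool m → (Fin m → F2^ N) → F2^ N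
lincomb {N} {m} c w = go m c (λ j → w j)
  where
  go : (m : ℕ) → Vec Bool m → (Fin m → F2^ N) → F2^ N
  go zero    _              _ = zeroV
  go (suc m) (Vec._∷_ x xs) f =
    (if x then f Fin.zero else zeroV) ⊕ go m xs (λ j → f (Fin.suc j))

weight : ∀ {m} → Vec Bool m → ℕ
weight c = foldr _ (λ b r → (if b then 1 else 0) + r) 0 c

Symmetric : ∀ {N} → (Fin N → Fin N → Bool) → Set
Symmetric adj = ∀ a b → adj a b ≡ adj b a

Loopless : ∀ {N} → (Fin N → Fin N → Bool) → Set
Loopless adj = ∀ a → adj a a ≡ false

data Reach {N} (adj : Fin N → Fin N → Bool) (a : Fin N) : Fin N → Set where
  here : Reach adj a a
  step : ∀ {b c} → Reach adj a b → adj b c ≡ true → Reach adj a c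

Connected : ∀ {N} → (Fin N → Fin N → Bool) → Set
Connected adj = ∀ a b → Reach adj a b

-- Graph on n = suc k vertices s₁,…,sₙ (vertex s_{j+1} is the Fin index j).
InducedPath : ∀ k → (Fin (suc k) → Fin (suc k) → Bool) → Set
InducedPath k adj = ∀ (a b : Fin (suc k)) → toℕ a < k → toℕ b < k →
  (adj a b ≡ true) ⇔ (toℕ a ≡ suc (toℕ b) ⊎ toℕ b ≡ suc (toℕ a))

module Setting (k : ℕ) (adj : Fin (suc k) → Fin (suc k) → Bool) where

  n : ℕ
  n = suc k

  sn : Fin n
  sn = fromℕ k

  -- the vertex with 0-based index j (s_{j+1}); only used for j < n
  vtx : ℕ → Fin n
  vtx j with j <? n
  ... | Relation.Nullary.yes p = fromℕ< p
  ... | Relation.Nullary.no  _ = fromℕ k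

  flipM : Fin n → Mat n
  flipM s a b = does (a ≟ b) ∨ (does (b ≟ s) ∧ adj a b)

  -- generators 𝐬₁,…,𝐬_{n-1} of 𝐖_P, indexed by Fin k (index i ↦ s_{i+1})
  gen : Fin k → Mat n
  gen i = flipM (inject₁ i)

  act : List (Fin k) → F2^ n → F2^ n
  act []       v = v
  act (i ∷ is) v = gen i · act is v

  InOrbit : F2^ n → F2^ n → Set
  InOrbit v w = Σ (List (Fin k)) λ g → w ≡ act g v

  -- bar j = \overline{j+1}:  \overline1 = s̃₁, \overline{i+1} = 𝐬ᵢ ⋯ 𝐬₁ \overline1
  bar : ℕ → F2^ n
  bar zero    = chr (vtx 0)
  bar (suc j) = flipM (vtx j) · bar j

  Π : Fin n → F2^ n
  Π j = bar (toℕ j)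

  card-Π₁ : ℕ
  card-Π₁ = length (filter (λ j → Data.Bool._≟_ ⟨ bar j , chr sn ⟩ true) (upTo n))

  InU : F2^ n → Set
  InU u = Σ (Vec Bool n) λ c → u ≡ lincomb c Π

  -- Δ = (Π ∪ {\overline{n+1}}) ∖ {\overline n} = {\overline1,…,\overline{n-1}, s̃_n}
  Δ : Fin n → F2^ n
  Δ j with toℕ j <? k
  ... | Relation.Nullary.yes _ = bar (toℕ j)
  ... | Relation.Nullary.no  _ = chr sn

  SW : F2^ n → ℕ → Set
  SW u w = Σ (Vec Bool n) λ c → (u ≡ lincomb c Δ) × (weight c ≡ w)

  -- U_T and \overline U_T for T = {t₁, t₂} (a singleton when t₁ = t₂)
  U-T : ℕ → ℕ → F2^ n → Set
  U-T t₁ t₂ u = InU u × Σ ℕ λ w → SW u w × (w ≡ t₁ ⊎ w ≡ t₂)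

  Ubar-T : ℕ → ℕ → F2^ n → Set
  Ubar-T t₁ t₂ u = ¬ InU u × Σ ℕ λ w → SW u w × (w ≡ t₁ ⊎ w ≡ t₂)

  data Listed : (F2^ n → Set) → Set₁ where
    ubar1 : Listed (Ubar-T 1 1)
    ubari : ∀ i → 1 ≤ i → i ≤ n / 2 → Listed (Ubar-T (suc i) (suc n Data.Nat.∸ i))
    ui    : ∀ i → 1 ≤ i → i ≤ n / 2 → Listed (U-T i (n Data.Nat.∸ i))

  IsOrbit : (F2^ n → Set) → Set
  IsOrbit X = Σ (F2^ n) λ v → ∀ w → X w ⇔ InOrbit v w

-- Write v ∈ F₂ⁿ as v = Σⱼ xⱼ \overline{j+1} + ε s̃ₙ.  On the path vertices \overline{j+1} is
-- s̃ⱼ + s̃ⱼ₊₁ (with s̃₀ = 0), so there v only sees the differences xⱼ + xⱼ₊₁ and not ε: x is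
-- determined up to complementation, and then ε is determined.  Since |Π₁| is even the \overline j
-- sum to zero, so complementing x does not change v, and normalising the last coefficient to 0
-- gives the expansion of v in Δ.  The flip 𝐬ᵢ exchanges \overline i and \overline{i+1} and fixes
-- s̃ₙ, so 𝐖_P acts on x by adjacent transpositions and fixes ε.  Hence the orbits are the sets
-- "ε fixed, weight of x in {w, n - w}": for ε = 0 this is U_{w,n-w}, for ε = 1 it is
-- \overline U_{w+1,n+1-w}, and \overline U_{1} when w = 0.

module Submission where

open import Defs

open import Algebra.Bundles using (CommutativeRing)
open import Data.Bool using (Bool; true; false; _∧_; _∨_; _xor_; if_then_else_; not)
import Data.Bool as Bool
open import Data.Bool.Properties
  using ( xor-∧-commutativeRing; xor-comm; xor-assoc; xor-same; xor-identityʳ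
        ; ∧-distribˡ-xor; ∧-zeroʳ; ∧-identityʳ; ∧-comm; not-involutive; ¬-not; not-¬
        ; ⇔→≡; T-≡; T-∨ )
open import Data.Empty using (⊥-elim)
open import Data.Fin using (Fin; zero; suc; toℕ; fromℕ; inject₁; _≟_)
open import Data.Fin.Properties
  using ( toℕ-fromℕ<; toℕ-fromℕ; toℕ≤pred[n]; fromℕ≢inject₁; toℕ-injective; toℕ-inject₁
        ; toℕ<n )
open import Data.Fin.Relation.Unary.Top using (view; ‵fromℕ; ‵inject₁)
open import Data.List as List using (List; []; _∷_; _++_; length; filter; applyUpTo)
open import Data.Nat
  using (ℕ; zero; suc; _≡ᵇ_; _%_; _/_; _*_; _+_; _∸_; _≤_; _<_; _≤?_; _<?_; z≤n; s≤s)
open import Data.Nat.DivMod using (m≡m%n+[m/n]*n; m%n<n; m/n≤m)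
open import Data.Nat.Properties
  using ( +-suc; +-assoc; *-comm; +-identityʳ; m+n∸n≡m; m+n∸m≡n; m∸[m∸n]≡n; +-∸-assoc
        ; ∸-monoˡ-≤; +-monoˡ-≤; +-mono-≤; ≤-pred; ≤-refl; ≤-trans; m≤n⇒m≤1+n; m<n⇒m<1+n
        ; m<n⇒0<n∸m; ≰⇒>; <⇒≤; <-irrefl; suc-injective; ≡ᵇ⇒≡; ≡⇒≡ᵇ; module ≤-Reasoning )
open import Data.Product using (Σ; _×_; _,_; proj₁; proj₂)
open import Data.Sum as Sum using (_⊎_; inj₁; inj₂)
open import Data.Vec
  using (Vec; []; _∷_; head; initLast; lookup; tabulate; replicate; map; _∷ʳ_)
open import Data.Vec.Properties
  using ( lookup∘tabulate; lookup-zipWith; lookup-replicate; lookup-map; tabulate∘lookup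
        ; tabulate-cong; zipWith-assoc; zipWith-comm; map-∷ʳ )
open import Function using (_∘_; id)
open import Function.Bundles using (_⇔_; mk⇔; Equivalence)
import Function.Properties.Equivalence as ⇔
open import Relation.Binary.PropositionalEquality
open import Relation.Nullary using (yes; no; does; ¬_)
open import Relation.Nullary.Decidable using (dec-false; dec-true)

open import Algebra.Properties.Semiring.Sum (CommutativeRing.semiring xor-∧-commutativeRing)
  using (sum-syntax; sum-cong-≗; ∑-distrib-+; sum-init-last; sum-replicate-zero)

n∸m≤n/2 : ∀ {n m} → n / 2 < m → n ∸ m ≤ n / 2
n∸m≤n/2 {n} {m} n/2<m = begin
  n ∸ m              ≤⟨ ∸-monoˡ-≤ m n≤m+n/2 ⟩
  m + n / 2 ∸ m      ≡⟨ m+n∸m≡n m (n / 2) ⟩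
  n / 2              ∎
  where
  open ≤-Reasoning
  n≤m+n/2 : n ≤ m + n / 2
  n≤m+n/2 = begin
    n                              ≡⟨ m≡m%n+[m/n]*n n 2 ⟩
    n % 2 + n / 2 * 2              ≡⟨ cong (n % 2 +_) (*-comm (n / 2) 2) ⟩
    n % 2 + (n / 2 + (n / 2 + 0))  ≡⟨ cong (λ h → n % 2 + (n / 2 + h)) (+-identityʳ (n / 2)) ⟩
    n % 2 + (n / 2 + n / 2)        ≡⟨ +-assoc (n % 2) (n / 2) (n / 2) ⟨
    n % 2 + n / 2 + n / 2          ≤⟨ +-monoˡ-≤ (n / 2) (+-mono-≤ (≤-pred (m%n<n n 2)) ≤-refl) ⟩
    suc (n / 2) + n / 2            ≤⟨ +-monoˡ-≤ (n / 2) n/2<m ⟩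
    m + n / 2                      ∎

fold-to-half : ∀ {n m} → 1 ≤ m → m < n →
  Σ ℕ λ i → 1 ≤ i × i ≤ n / 2 × (m ≡ i ⊎ m ≡ n ∸ i)
fold-to-half {n} {m} 1≤m m<n with m ≤? n / 2
... | yes m≤n/2 = m , 1≤m , m≤n/2 , inj₁ refl
... | no m≰n/2  = n ∸ m , m<n⇒0<n∸m m<n , n∸m≤n/2 (≰⇒> m≰n/2) , inj₂ (sym (m∸[m∸n]≡n (<⇒≤ m<n)))

does-≟ : ∀ {N} (a b : Fin N) → does (a ≟ b) ≡ (toℕ a ≡ᵇ toℕ b)
does-≟ zero    zero    = refl
does-≟ zero    (suc b) = refl
does-≟ (suc a) zero    = refl
does-≟ (suc a) (suc b) = does-≟ a b

≡ᵇ-refl : ∀ m → (m ≡ᵇ m) ≡ true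
≡ᵇ-refl zero    = refl
≡ᵇ-refl (suc m) = ≡ᵇ-refl m

≡ᵇ-comm : ∀ m t → (m ≡ᵇ t) ≡ (t ≡ᵇ m)
≡ᵇ-comm zero    zero    = refl
≡ᵇ-comm zero    (suc t) = refl
≡ᵇ-comm (suc m) zero    = refl
≡ᵇ-comm (suc m) (suc t) = ≡ᵇ-comm m t

≡ᵇ-suc : ∀ m → (suc m ≡ᵇ m) ≡ false
≡ᵇ-suc zero    = refl
≡ᵇ-suc (suc m) = ≡ᵇ-suc m

path-step : ∀ t m →
  ((t ≡ᵇ m) xor (suc t ≡ᵇ m)) xor ((t ≡ᵇ suc m) ∨ (m ≡ᵇ suc t)) ≡ (t ≡ᵇ suc m) xor (t ≡ᵇ m)
path-step zero          zero          = refl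
path-step zero          (suc zero)    = refl
path-step zero          (suc (suc m)) = refl
path-step (suc zero)    zero          = refl
path-step (suc (suc t)) zero          = refl
path-step (suc t)       (suc m)       = path-step t m

parity : ℕ → Bool
parity zero    = false
parity (suc m) = not (parity m)

parity-even : ∀ m → m % 2 ≡ 0 → parity m ≡ false
parity-even zero          _ = refl
parity-even (suc (suc m)) p = trans (not-involutive (parity m)) (parity-even m p)

open ≡-Reasoning

-- Linear algebra over F₂

xor-cancelʳ : ∀ a b → (a xor b) xor b ≡ a
xor-cancelʳ a b = trans (xor-assoc a b b) (trans (cong (a xor_) (xor-same b)) (xor-identityʳ a))

sum-δ : ∀ {N} (a : Fin N) (g : Fin N → Bool) → ∑[ b < N ] (does (b ≟ a) ∧ g b) ≡ g a
sum-δ {suc N} zero    g = trans (cong (g zero xor_) (sum-replicate-zero N)) (xor-identityʳ (g zero))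
sum-δ {suc N} (suc a) g = sum-δ a (λ b → g (suc b))

sum≡parity-count : ∀ N (f : ℕ → ℕ) (G : ℕ → Bool) →
  ∑[ j < N ] G (f (toℕ j)) ≡ parity (length (filter (λ j → G j Bool.≟ true) (applyUpTo f N)))
sum≡parity-count zero    f G = refl
sum≡parity-count (suc N) f G with G (f 0)
... | true  = cong not (sum≡parity-count N (f ∘ suc) G)
... | false = sum≡parity-count N (f ∘ suc) G

≡-by-lookup : ∀ {A : Set} {N} {u v : Vec A N} → (∀ i → lookup u i ≡ lookup v i) → u ≡ v
≡-by-lookup {u = u} {v} p = begin
  u                      ≡⟨ tabulate∘lookup u ⟨
  tabulate (lookup u)    ≡⟨ tabulate-cong p ⟩
  tabulate (lookup v)    ≡⟨ tabulate∘lookup v ⟩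
  v                      ∎

lookup-⊕ : ∀ {N} (u v : F2^ N) i → lookup (u ⊕ v) i ≡ lookup u i xor lookup v i
lookup-⊕ u v i = lookup-zipWith _xor_ i u v

lookup-zeroV : ∀ {N} (i : Fin N) → lookup zeroV i ≡ false
lookup-zeroV i = lookup-replicate i false

lookup-if-zeroV : ∀ {N} e (u : F2^ N) i → lookup (if e then u else zeroV) i ≡ e ∧ lookup u i
lookup-if-zeroV true  u i = refl
lookup-if-zeroV false u i = lookup-zeroV i

lookup-chr : ∀ {N} (s b : Fin N) → lookup (chr s) b ≡ does (b ≟ s)
lookup-chr s b = lookup∘tabulate _ b

⊕-identityʳ : ∀ {N} (u : F2^ N) → u ⊕ zeroV ≡ u
⊕-identityʳ u = ≡-by-lookup λ i →
  trans (lookup-⊕ u zeroV i) (trans (cong (lookup u i xor_) (lookup-zeroV i)) (xor-identityʳ _))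

⊕-assoc : ∀ {N} (u v w : F2^ N) → (u ⊕ v) ⊕ w ≡ u ⊕ (v ⊕ w)
⊕-assoc = zipWith-assoc xor-assoc

⊕-comm : ∀ {N} (u v : F2^ N) → u ⊕ v ≡ v ⊕ u
⊕-comm = zipWith-comm xor-comm

⊕-left-comm : ∀ {N} (u v w : F2^ N) → u ⊕ (v ⊕ w) ≡ v ⊕ (u ⊕ w)
⊕-left-comm u v w = begin
  u ⊕ (v ⊕ w)   ≡⟨ ⊕-assoc u v w ⟨
  (u ⊕ v) ⊕ w   ≡⟨ cong (_⊕ w) (⊕-comm u v) ⟩
  (v ⊕ u) ⊕ w   ≡⟨ ⊕-assoc v u w ⟩
  v ⊕ (u ⊕ w)   ∎

⟨⟩-as-sum : ∀ {N} (u v : F2^ N) → ⟨ u , v ⟩ ≡ ∑[ b < N ] (lookup u b ∧ lookup v b)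
⟨⟩-as-sum []      []      = refl
⟨⟩-as-sum (a ∷ u) (b ∷ v) = cong ((a ∧ b) xor_) (⟨⟩-as-sum u v)

⟨⟩-chr : ∀ {N} (u : F2^ N) s → ⟨ u , chr s ⟩ ≡ lookup u s
⟨⟩-chr {N} u s = begin
  ⟨ u , chr s ⟩
    ≡⟨ ⟨⟩-as-sum u (chr s) ⟩
  ∑[ b < N ] (lookup u b ∧ lookup (chr s) b)
    ≡⟨ sum-cong-≗ (λ b → trans (cong (lookup u b ∧_) (lookup-chr s b)) (∧-comm (lookup u b) _)) ⟩
  ∑[ b < N ] (does (b ≟ s) ∧ lookup u b)
    ≡⟨ sum-δ s (lookup u) ⟩
  lookup u s
    ∎

lookup-· : ∀ {N} (M : Mat N) v a → lookup (M · v) a ≡ ∑[ b < N ] (M a b ∧ lookup v b)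
lookup-· {N} M v a = begin
  lookup (M · v) a
    ≡⟨ lookup∘tabulate _ a ⟩
  ⟨ tabulate (M a) , v ⟩
    ≡⟨ ⟨⟩-as-sum (tabulate (M a)) v ⟩
  ∑[ b < N ] (lookup (tabulate (M a)) b ∧ lookup v b)
    ≡⟨ sum-cong-≗ (λ b → cong (_∧ lookup v b) (lookup∘tabulate (M a) b)) ⟩
  ∑[ b < N ] (M a b ∧ lookup v b)
    ∎

·-⊕ : ∀ {N} (M : Mat N) u v → M · (u ⊕ v) ≡ (M · u) ⊕ (M · v)
·-⊕ {N} M u v = ≡-by-lookup λ a → begin
  lookup (M · (u ⊕ v)) a
    ≡⟨ lookup-· M (u ⊕ v) a ⟩
  ∑[ b < N ] (M a b ∧ lookup (u ⊕ v) b)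
    ≡⟨ sum-cong-≗ (λ b → trans (cong (M a b ∧_) (lookup-⊕ u v b)) (∧-distribˡ-xor (M a b) _ _)) ⟩
  ∑[ b < N ] ((M a b ∧ lookup u b) xor (M a b ∧ lookup v b))
    ≡⟨ ∑-distrib-+ (λ b → M a b ∧ lookup u b) (λ b → M a b ∧ lookup v b) ⟩
  ∑[ b < N ] (M a b ∧ lookup u b) xor ∑[ b < N ] (M a b ∧ lookup v b)
    ≡⟨ cong₂ _xor_ (lookup-· M u a) (lookup-· M v a) ⟨
  lookup (M · u) a xor lookup (M · v) a
    ≡⟨ lookup-⊕ (M · u) (M · v) a ⟨
  lookup ((M · u) ⊕ (M · v)) a
    ∎

·-zeroV : ∀ {N} (M : Mat N) → M · zeroV ≡ zeroV
·-zeroV {N} M = ≡-by-lookup λ a → begin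
  lookup (M · zeroV) a
    ≡⟨ lookup-· M zeroV a ⟩
  ∑[ b < N ] (M a b ∧ lookup zeroV b)
    ≡⟨ sum-cong-≗ (λ b → trans (cong (M a b ∧_) (lookup-zeroV b)) (∧-zeroʳ (M a b))) ⟩
  ∑[ b < N ] false
    ≡⟨ sum-replicate-zero N ⟩
  false
    ≡⟨ lookup-zeroV a ⟨
  lookup zeroV a
    ∎

lookup-lincomb : ∀ {N m} (c : Vec Bool m) (w : Fin m → F2^ N) t →
  lookup (lincomb c w) t ≡ ∑[ j < m ] (lookup c j ∧ lookup (w j) t)
lookup-lincomb []       w t = lookup-zeroV t
lookup-lincomb (x ∷ xs) w t = begin
  lookup ((if x then w zero else zeroV) ⊕ lincomb xs (λ j → w (suc j))) t
    ≡⟨ lookup-⊕ (if x then w zero else zeroV) _ t ⟩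
  lookup (if x then w zero else zeroV) t xor lookup (lincomb xs (λ j → w (suc j))) t
    ≡⟨ cong₂ _xor_ (lookup-if-zeroV x (w zero) t) (lookup-lincomb xs (λ j → w (suc j)) t) ⟩
  (x ∧ lookup (w zero) t) xor ∑[ j < _ ] (lookup xs j ∧ lookup (w (suc j)) t)
    ∎

lincomb-cong : ∀ {N m} (c : Vec Bool m) {w w′ : Fin m → F2^ N} →
  (∀ j → w j ≡ w′ j) → lincomb c w ≡ lincomb c w′
lincomb-cong c p = ≡-by-lookup λ t → trans (lookup-lincomb c _ t)
  (trans (sum-cong-≗ (λ j → cong (λ u → lookup c j ∧ lookup u t) (p j))) (sym (lookup-lincomb c _ t)))

·-lincomb : ∀ {N m} (M : Mat N) (c : Vec Bool m) w → M · lincomb c w ≡ lincomb c (λ j → M · w j)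
·-lincomb M []           w = ·-zeroV M
·-lincomb M (true  ∷ xs) w =
  trans (·-⊕ M (w zero) _) (cong ((M · w zero) ⊕_) (·-lincomb M xs (λ j → w (suc j))))
·-lincomb M (false ∷ xs) w =
  trans (·-⊕ M zeroV _) (cong₂ _⊕_ (·-zeroV M) (·-lincomb M xs (λ j → w (suc j))))

lincomb-replicate-false : ∀ {N} m (w : Fin m → F2^ N) → lincomb (replicate m false) w ≡ zeroV
lincomb-replicate-false m w = ≡-by-lookup λ t → begin
  lookup (lincomb (replicate m false) w) t
    ≡⟨ lookup-lincomb (replicate m false) w t ⟩
  ∑[ j < m ] (lookup (replicate m false) j ∧ lookup (w j) t)
    ≡⟨ sum-cong-≗ (λ j → cong (_∧ lookup (w j) t) (lookup-replicate j false)) ⟩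
  ∑[ j < m ] false
    ≡⟨ sum-replicate-zero m ⟩
  false
    ≡⟨ lookup-zeroV t ⟨
  lookup zeroV t
    ∎

lincomb-map-not : ∀ {N m} (c : Vec Bool m) (w : Fin m → F2^ N) →
  (∀ t → ∑[ j < m ] lookup (w j) t ≡ false) → lincomb (map not c) w ≡ lincomb c w
lincomb-map-not {m = m} c w Σw≡0 = ≡-by-lookup λ t → begin
  lookup (lincomb (map not c) w) t
    ≡⟨ lookup-lincomb (map not c) w t ⟩
  ∑[ j < m ] (lookup (map not c) j ∧ lookup (w j) t)
    ≡⟨ sum-cong-≗ (λ j → trans (cong (_∧ lookup (w j) t) (lookup-map j not c)) (not-∧ (lookup c j) _)) ⟩
  ∑[ j < m ] ((lookup c j ∧ lookup (w j) t) xor lookup (w j) t)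
    ≡⟨ ∑-distrib-+ (λ j → lookup c j ∧ lookup (w j) t) (λ j → lookup (w j) t) ⟩
  ∑[ j < m ] (lookup c j ∧ lookup (w j) t) xor ∑[ j < m ] lookup (w j) t
    ≡⟨ cong₂ _xor_ (lookup-lincomb c w t) (sym (Σw≡0 t)) ⟨
  lookup (lincomb c w) t xor false
    ≡⟨ xor-identityʳ _ ⟩
  lookup (lincomb c w) t
    ∎
  where
  not-∧ : ∀ a b → not a ∧ b ≡ (a ∧ b) xor b
  not-∧ true  b = sym (xor-same b)
  not-∧ false b = refl

lookup-∷ʳ-inject₁ : ∀ {A : Set} {k} (xs : Vec A k) e i → lookup (xs ∷ʳ e) (inject₁ i) ≡ lookup xs i
lookup-∷ʳ-inject₁ (x ∷ xs) e zero    = refl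
lookup-∷ʳ-inject₁ (x ∷ xs) e (suc i) = lookup-∷ʳ-inject₁ xs e i

lookup-∷ʳ-fromℕ : ∀ {A : Set} {k} (xs : Vec A k) e → lookup (xs ∷ʳ e) (fromℕ k) ≡ e
lookup-∷ʳ-fromℕ []       e = refl
lookup-∷ʳ-fromℕ (x ∷ xs) e = lookup-∷ʳ-fromℕ xs e

lookup-lincomb-∷ʳ : ∀ {N k} (ys : Vec Bool k) e (w : Fin (suc k) → F2^ N) t →
  lookup (lincomb (ys ∷ʳ e) w) t
    ≡ ∑[ i < k ] (lookup ys i ∧ lookup (w (inject₁ i)) t) xor (e ∧ lookup (w (fromℕ k)) t)
lookup-lincomb-∷ʳ {k = k} ys e w t = begin
  lookup (lincomb (ys ∷ʳ e) w) t
    ≡⟨ lookup-lincomb (ys ∷ʳ e) w t ⟩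
  ∑[ j < suc k ] (c j ∧ lookup (w j) t)
    ≡⟨ sum-init-last (λ j → c j ∧ lookup (w j) t) ⟩
  ∑[ i < k ] (c (inject₁ i) ∧ lookup (w (inject₁ i)) t) xor (c (fromℕ k) ∧ lookup (w (fromℕ k)) t)
    ≡⟨ cong₂ _xor_ (sum-cong-≗ (λ i → cong (_∧ lookup (w (inject₁ i)) t) (lookup-∷ʳ-inject₁ ys e i)))
                   (cong (_∧ lookup (w (fromℕ k)) t) (lookup-∷ʳ-fromℕ ys e)) ⟩
  ∑[ i < k ] (lookup ys i ∧ lookup (w (inject₁ i)) t) xor (e ∧ lookup (w (fromℕ k)) t)
    ∎
  where
  c = lookup (ys ∷ʳ e)

-- Adjacent transpositions and weights

σ : ∀ {k} → Fin k → Fin (suc k) → Fin (suc k)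
σ zero    zero          = suc zero
σ zero    (suc zero)    = zero
σ zero    (suc (suc j)) = suc (suc j)
σ (suc i) zero          = zero
σ (suc i) (suc j)       = suc (σ i j)

σ-inject₁ : ∀ {k} (i : Fin k) → σ i (inject₁ i) ≡ suc i
σ-inject₁ zero    = refl
σ-inject₁ (suc i) = cong suc (σ-inject₁ i)

σ-suc : ∀ {k} (i : Fin k) → σ i (suc i) ≡ inject₁ i
σ-suc zero    = refl
σ-suc (suc i) = cong suc (σ-suc i)

σ-fixes : ∀ {k} (i : Fin k) j → j ≢ inject₁ i → j ≢ suc i → σ i j ≡ j
σ-fixes zero    zero          j≢i _     = ⊥-elim (j≢i refl)
σ-fixes zero    (suc zero)    _   j≢i+1 = ⊥-elim (j≢i+1 refl)
σ-fixes zero    (suc (suc j)) _   _     = refl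
σ-fixes (suc i) zero          _   _     = refl
σ-fixes (suc i) (suc j)       j≢i j≢i+1 = cong suc (σ-fixes i j (j≢i ∘ cong suc) (j≢i+1 ∘ cong suc))

swapAt : ∀ {A : Set} {k} → Fin k → Vec A (suc k) → Vec A (suc k)
swapAt zero    (a ∷ b ∷ xs) = b ∷ a ∷ xs
swapAt (suc i) (a ∷ xs)     = a ∷ swapAt i xs

lincomb-σ : ∀ {N k} (i : Fin k) (c : Vec Bool (suc k)) (w : Fin (suc k) → F2^ N) →
  lincomb c (λ j → w (σ i j)) ≡ lincomb (swapAt i c) w
lincomb-σ zero    (a ∷ b ∷ xs) w = ⊕-left-comm _ _ _
lincomb-σ (suc i) (a ∷ xs)     w =
  cong ((if a then w zero else zeroV) ⊕_) (lincomb-σ i xs (λ j → w (suc j)))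

weight-map-not+weight : ∀ {N} (x : Vec Bool N) → weight (map not x) + weight x ≡ N
weight-map-not+weight []           = refl
weight-map-not+weight (true  ∷ xs) =
  trans (+-suc (weight (map not xs)) (weight xs)) (cong suc (weight-map-not+weight xs))
weight-map-not+weight (false ∷ xs) = cong suc (weight-map-not+weight xs)

weight-map-not : ∀ {N} (x : Vec Bool N) → weight (map not x) ≡ N ∸ weight x
weight-map-not {N} x = begin
  weight (map not x)                        ≡⟨ m+n∸n≡m (weight (map not x)) (weight x) ⟨
  weight (map not x) + weight x ∸ weight x  ≡⟨ cong (_∸ weight x) (weight-map-not+weight x) ⟩
  N ∸ weight x                              ∎

weight≤length : ∀ {N} (x : Vec Bool N) → weight x ≤ N
weight≤length []           = z≤n
weight≤length (true  ∷ xs) = s≤s (weight≤length xs)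
weight≤length (false ∷ xs) = m≤n⇒m≤1+n (weight≤length xs)

weight≡0⇒replicate : ∀ {N} (x : Vec Bool N) → weight x ≡ 0 → x ≡ replicate N false
weight≡0⇒replicate []           _ = refl
weight≡0⇒replicate (false ∷ xs) p = cong (false ∷_) (weight≡0⇒replicate xs p)

weight-∷ʳ-false : ∀ {N} (x : Vec Bool N) → weight (x ∷ʳ false) ≡ weight x
weight-∷ʳ-false []           = refl
weight-∷ʳ-false (true  ∷ xs) = cong suc (weight-∷ʳ-false xs)
weight-∷ʳ-false (false ∷ xs) = weight-∷ʳ-false xs

weight-∷ʳ-true : ∀ {N} (x : Vec Bool N) → weight (x ∷ʳ true) ≡ suc (weight x)
weight-∷ʳ-true []           = refl
weight-∷ʳ-true (true  ∷ xs) = cong suc (weight-∷ʳ-true xs)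
weight-∷ʳ-true (false ∷ xs) = weight-∷ʳ-true xs

weight-swapAt : ∀ {k} (i : Fin k) (x : Vec Bool (suc k)) → weight (swapAt i x) ≡ weight x
weight-swapAt zero    (true  ∷ true  ∷ xs) = refl
weight-swapAt zero    (true  ∷ false ∷ xs) = refl
weight-swapAt zero    (false ∷ true  ∷ xs) = refl
weight-swapAt zero    (false ∷ false ∷ xs) = refl
weight-swapAt (suc i) (true  ∷ xs)         = cong suc (weight-swapAt i xs)
weight-swapAt (suc i) (false ∷ xs)         = weight-swapAt i xs

swaps : ∀ {A : Set} {k} → List (Fin k) → Vec A (suc k) → Vec A (suc k)
swaps []      x = x
swaps (i ∷ g) x = swapAt i (swaps g x)

swaps-++ : ∀ {A : Set} {k} (g h : List (Fin k)) (x : Vec A (suc k)) →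
  swaps (g ++ h) x ≡ swaps g (swaps h x)
swaps-++ []      h x = refl
swaps-++ (i ∷ g) h x = cong (swapAt i) (swaps-++ g h x)

weight-swaps : ∀ {k} (g : List (Fin k)) x → weight (swaps g x) ≡ weight x
weight-swaps []      x = refl
weight-swaps (i ∷ g) x = trans (weight-swapAt i (swaps g x)) (weight-swaps g x)

infix 4 _↝_
_↝_ : ∀ {k} → Vec Bool (suc k) → Vec Bool (suc k) → Set
_↝_ {k} x y = Σ (List (Fin k)) λ g → swaps g x ≡ y

↝-trans : ∀ {k} {x y z : Vec Bool (suc k)} → x ↝ y → y ↝ z → x ↝ z
↝-trans {x = x} (g , refl) (h , refl) = h ++ g , swaps-++ h g x

↝-cons : ∀ {k} a {x y : Vec Bool (suc k)} → x ↝ y → a ∷ x ↝ a ∷ y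
↝-cons a {x} (g , refl) = List.map suc g , lift g
  where
  lift : ∀ g → swaps (List.map suc g) (a ∷ x) ≡ a ∷ swaps g x
  lift []      = refl
  lift (i ∷ g) = cong (swapAt (suc i)) (lift g)

↝-swap₀ : ∀ {k} a b (xs : Vec Bool k) → a ∷ b ∷ xs ↝ b ∷ a ∷ xs
↝-swap₀ a b xs = zero ∷ [] , refl

ones : ∀ N → ℕ → Vec Bool N
ones zero    _       = []
ones (suc N) zero    = false ∷ ones N zero
ones (suc N) (suc w) = true ∷ ones N w

weight-ones : ∀ {N w} → w ≤ N → weight (ones N w) ≡ w
weight-ones {zero}  z≤n     = refl
weight-ones {suc N} z≤n     = weight-ones {N} z≤n
weight-ones {suc N} (s≤s p) = cong suc (weight-ones p)

ones↝false∷ones : ∀ {N w} → w ≤ N → ones (suc N) w ↝ false ∷ ones N w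
ones↝false∷ones {N}     {zero}  _       = [] , refl
ones↝false∷ones {suc N} {suc w} (s≤s p) =
  ↝-trans (↝-cons true (ones↝false∷ones p)) (↝-swap₀ true false (ones N w))

ones↝ : ∀ {N} (y : Vec Bool (suc N)) → ones (suc N) (weight y) ↝ y
ones↝ {zero}  (true  ∷ []) = [] , refl
ones↝ {zero}  (false ∷ []) = [] , refl
ones↝ {suc N} (true  ∷ ys) = ↝-cons true (ones↝ ys)
ones↝ {suc N} (false ∷ ys) = ↝-trans (ones↝false∷ones (weight≤length ys)) (↝-cons false (ones↝ ys))

-- Differences along the path

∂ : ∀ {k} → Vec Bool (suc k) → Vec Bool k
∂ {zero}  _       = []
∂ {suc k} (a ∷ x) = (a xor head x) ∷ ∂ x

lookup-∂ : ∀ {k} (x : Vec Bool (suc k)) i → lookup (∂ x) i ≡ lookup x (inject₁ i) xor lookup x (suc i)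
lookup-∂ (a ∷ b ∷ x) zero    = refl
lookup-∂ (a ∷ x)     (suc i) = lookup-∂ x i

∫ : ∀ {k} → Vec Bool k → Vec Bool k
∫ []      = []
∫ (a ∷ w) = (a xor head (∫ w ∷ʳ false)) ∷ ∫ w

∂-∫ : ∀ {k} (w : Vec Bool k) → ∂ (∫ w ∷ʳ false) ≡ w
∂-∫ []      = refl
∂-∫ (a ∷ w) = cong₂ _∷_ (xor-cancelʳ a (head (∫ w ∷ʳ false))) (∂-∫ w)

∫-∂ : ∀ {k} (y : Vec Bool k) → ∫ (∂ (y ∷ʳ false)) ≡ y
∫-∂ []       = refl
∫-∂ (a ∷ ys) rewrite ∫-∂ ys = cong (_∷ ys) (xor-cancelʳ a (head (ys ∷ʳ false)))

-- Flips along the induced path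

module PathFlips (k : ℕ) (adj : Fin (suc k) → Fin (suc k) → Bool)
                 (loopless : Loopless adj) (path : InducedPath k adj) where

  open Setting k adj

  -- The two disjuncts of flipM s a b overlap only when a = b = s, which looplessness rules out.
  flip-entry : ∀ (s a b : Fin n) x →
    flipM s a b ∧ x ≡ (does (b ≟ a) ∧ x) xor (does (b ≟ s) ∧ (adj a b ∧ x))
  flip-entry s a b x with a ≟ b | b ≟ a | b ≟ s
  ... | yes refl | yes _    | yes refl =
    trans (sym (xor-identityʳ x)) (cong (λ e → x xor (e ∧ x)) (sym (loopless a)))
  ... | yes refl | yes _    | no _     = sym (xor-identityʳ x)
  ... | yes refl | no a≢a   | _        = ⊥-elim (a≢a refl)
  ... | no b≢b   | yes refl | _        = ⊥-elim (b≢b refl)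
  ... | no _     | no _     | yes _    = refl
  ... | no _     | no _     | no _     = refl

  lookup-flip : ∀ s v a → lookup (flipM s · v) a ≡ lookup v a xor (adj a s ∧ lookup v s)
  lookup-flip s v a = begin
    lookup (flipM s · v) a
      ≡⟨ lookup-· (flipM s) v a ⟩
    ∑[ b < n ] (flipM s a b ∧ lookup v b)
      ≡⟨ sum-cong-≗ (λ b → flip-entry s a b (lookup v b)) ⟩
    ∑[ b < n ] ((does (b ≟ a) ∧ lookup v b) xor (does (b ≟ s) ∧ (adj a b ∧ lookup v b)))
      ≡⟨ ∑-distrib-+ (λ b → does (b ≟ a) ∧ lookup v b) (λ b → does (b ≟ s) ∧ (adj a b ∧ lookup v b)) ⟩
    ∑[ b < n ] (does (b ≟ a) ∧ lookup v b) xor ∑[ b < n ] (does (b ≟ s) ∧ (adj a b ∧ lookup v b))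
      ≡⟨ cong₂ _xor_ (sum-δ a (lookup v)) (sum-δ s (λ b → adj a b ∧ lookup v b)) ⟩
    lookup v a xor (adj a s ∧ lookup v s)
      ∎

  lookup-flip-self : ∀ s v → lookup (flipM s · v) s ≡ lookup v s
  lookup-flip-self s v = begin
    lookup (flipM s · v) s                   ≡⟨ lookup-flip s v s ⟩
    lookup v s xor (adj s s ∧ lookup v s)    ≡⟨ cong (λ e → lookup v s xor (e ∧ lookup v s)) (loopless s) ⟩
    lookup v s xor false                     ≡⟨ xor-identityʳ (lookup v s) ⟩
    lookup v s                               ∎

  flip-involutive : ∀ s v → flipM s · (flipM s · v) ≡ v
  flip-involutive s v = ≡-by-lookup λ a → begin
    lookup (flipM s · (flipM s · v)) a
      ≡⟨ lookup-flip s (flipM s · v) a ⟩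
    lookup (flipM s · v) a xor (adj a s ∧ lookup (flipM s · v) s)
      ≡⟨ cong₂ (λ p q → p xor (adj a s ∧ q)) (lookup-flip s v a) (lookup-flip-self s v) ⟩
    (lookup v a xor (adj a s ∧ lookup v s)) xor (adj a s ∧ lookup v s)
      ≡⟨ xor-cancelʳ (lookup v a) (adj a s ∧ lookup v s) ⟩
    lookup v a
      ∎

  flip-fixes : ∀ s v → lookup v s ≡ false → flipM s · v ≡ v
  flip-fixes s v vₛ≡0 = ≡-by-lookup λ a → begin
    lookup (flipM s · v) a                   ≡⟨ lookup-flip s v a ⟩
    lookup v a xor (adj a s ∧ lookup v s)    ≡⟨ cong (λ q → lookup v a xor (adj a s ∧ q)) vₛ≡0 ⟩
    lookup v a xor (adj a s ∧ false)         ≡⟨ cong (lookup v a xor_) (∧-zeroʳ (adj a s)) ⟩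
    lookup v a xor false                     ≡⟨ xor-identityʳ (lookup v a) ⟩
    lookup v a                               ∎

  toℕ-vtx : ∀ m → m < n → toℕ (vtx m) ≡ m
  toℕ-vtx m m<n with m <? n
  ... | yes p  = toℕ-fromℕ< p
  ... | no m≮n = ⊥-elim (m≮n m<n)

  vtx-toℕ : ∀ (i : Fin k) → vtx (toℕ i) ≡ inject₁ i
  vtx-toℕ i = toℕ-injective (trans (toℕ-vtx (toℕ i) (m<n⇒m<1+n (toℕ<n i))) (sym (toℕ-inject₁ i)))

  inject₁<k : ∀ (i : Fin k) → toℕ (inject₁ i) < k
  inject₁<k i = subst (_< k) (sym (toℕ-inject₁ i)) (toℕ<n i)

  adj-path : ∀ a b → toℕ a < k → toℕ b < k →
    adj a b ≡ ((toℕ a ≡ᵇ suc (toℕ b)) ∨ (toℕ b ≡ᵇ suc (toℕ a)))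
  adj-path a b a<k b<k = ⇔→≡ (⇔.trans (path a b a<k b<k) (mk⇔ reflect-to reflect-from))
    where
    reflect-to : toℕ a ≡ suc (toℕ b) ⊎ toℕ b ≡ suc (toℕ a) →
      ((toℕ a ≡ᵇ suc (toℕ b)) ∨ (toℕ b ≡ᵇ suc (toℕ a))) ≡ true
    reflect-to p = Equivalence.to T-≡ (Equivalence.from T-∨ (Sum.map (≡⇒≡ᵇ _ _) (≡⇒≡ᵇ _ _) p))
    reflect-from : ((toℕ a ≡ᵇ suc (toℕ b)) ∨ (toℕ b ≡ᵇ suc (toℕ a))) ≡ true →
      toℕ a ≡ suc (toℕ b) ⊎ toℕ b ≡ suc (toℕ a)
    reflect-from p = Sum.map (≡ᵇ⇒≡ _ _) (≡ᵇ⇒≡ _ _) (Equivalence.to T-∨ (Equivalence.from T-≡ p))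

  -- On the path, \overline{m+1} = s̃_m + s̃_{m+1}; the coordinate t is the vertex s_{t+1}.
  lookup-bar-path : ∀ m → m ≤ k → ∀ t → toℕ t < k →
    lookup (bar m) t ≡ (toℕ t ≡ᵇ m) xor (suc (toℕ t) ≡ᵇ m)
  lookup-bar-path zero _ t _ = begin
    lookup (chr (vtx 0)) t      ≡⟨ lookup-chr (vtx 0) t ⟩
    does (t ≟ vtx 0)            ≡⟨ does-≟ t (vtx 0) ⟩
    (toℕ t ≡ᵇ toℕ (vtx 0))      ≡⟨ cong (toℕ t ≡ᵇ_) (toℕ-vtx 0 (s≤s z≤n)) ⟩
    (toℕ t ≡ᵇ 0)                ≡⟨ xor-identityʳ _ ⟨
    (toℕ t ≡ᵇ 0) xor false      ∎
  lookup-bar-path (suc m) m<k t t<k = begin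
    lookup (flipM (vtx m) · bar m) t
      ≡⟨ lookup-flip (vtx m) (bar m) t ⟩
    lookup (bar m) t xor (adj t (vtx m) ∧ lookup (bar m) (vtx m))
      ≡⟨ cong₂ _xor_ (lookup-bar-path m m≤k t t<k) (trans (cong₂ _∧_ adj-t-m bar-m-at-m) (∧-identityʳ _)) ⟩
    ((toℕ t ≡ᵇ m) xor (suc (toℕ t) ≡ᵇ m)) xor ((toℕ t ≡ᵇ suc m) ∨ (m ≡ᵇ suc (toℕ t)))
      ≡⟨ path-step (toℕ t) m ⟩
    (toℕ t ≡ᵇ suc m) xor (toℕ t ≡ᵇ m)
      ∎
    where
    m≤k : m ≤ k
    m≤k = <⇒≤ m<k
    toℕ-vtx-m : toℕ (vtx m) ≡ m
    toℕ-vtx-m = toℕ-vtx m (s≤s m≤k)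
    vtx-m<k : toℕ (vtx m) < k
    vtx-m<k = subst (_< k) (sym toℕ-vtx-m) m<k
    adj-t-m : adj t (vtx m) ≡ ((toℕ t ≡ᵇ suc m) ∨ (m ≡ᵇ suc (toℕ t)))
    adj-t-m = trans (adj-path t (vtx m) t<k vtx-m<k)
                    (cong (λ q → (toℕ t ≡ᵇ suc q) ∨ (q ≡ᵇ suc (toℕ t))) toℕ-vtx-m)
    bar-m-at-m : lookup (bar m) (vtx m) ≡ true
    bar-m-at-m = begin
      lookup (bar m) (vtx m)                            ≡⟨ lookup-bar-path m m≤k (vtx m) vtx-m<k ⟩
      (toℕ (vtx m) ≡ᵇ m) xor (suc (toℕ (vtx m)) ≡ᵇ m)   ≡⟨ cong (λ q → (q ≡ᵇ m) xor (suc q ≡ᵇ m)) toℕ-vtx-m ⟩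
      (m ≡ᵇ m) xor (suc m ≡ᵇ m)                         ≡⟨ cong₂ _xor_ (≡ᵇ-refl m) (≡ᵇ-suc m) ⟩
      true                                              ∎

  lookup-Π-path : ∀ j (i : Fin k) → lookup (Π j) (inject₁ i) ≡ does (j ≟ inject₁ i) xor does (j ≟ suc i)
  lookup-Π-path j i = begin
    lookup (bar (toℕ j)) (inject₁ i)
      ≡⟨ lookup-bar-path (toℕ j) (toℕ≤pred[n] j) (inject₁ i) (inject₁<k i) ⟩
    (toℕ (inject₁ i) ≡ᵇ toℕ j) xor (suc (toℕ (inject₁ i)) ≡ᵇ toℕ j)
      ≡⟨ cong (λ q → (q ≡ᵇ toℕ j) xor (suc q ≡ᵇ toℕ j)) (toℕ-inject₁ i) ⟩
    (toℕ i ≡ᵇ toℕ j) xor (suc (toℕ i) ≡ᵇ toℕ j)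
      ≡⟨ cong₂ _xor_ (≡ᵇ-comm (toℕ i) (toℕ j)) (≡ᵇ-comm (suc (toℕ i)) (toℕ j)) ⟩
    (toℕ j ≡ᵇ toℕ i) xor (toℕ j ≡ᵇ suc (toℕ i))
      ≡⟨ cong₂ _xor_ (trans (does-≟ j (inject₁ i)) (cong (toℕ j ≡ᵇ_) (toℕ-inject₁ i))) (does-≟ j (suc i)) ⟨
    does (j ≟ inject₁ i) xor does (j ≟ suc i)
      ∎

  lookup-s̃ₙ-path : ∀ (i : Fin k) → lookup (chr sn) (inject₁ i) ≡ false
  lookup-s̃ₙ-path i =
    trans (lookup-chr sn (inject₁ i)) (dec-false (inject₁ i ≟ fromℕ k) (fromℕ≢inject₁ ∘ sym))

  gen-Π : ∀ i j → gen i · Π j ≡ Π (σ i j)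
  gen-Π i j with j ≟ inject₁ i | j ≟ suc i
  ... | yes refl | _ = begin
    flipM (inject₁ i) · bar (toℕ (inject₁ i))
      ≡⟨ cong₂ (λ s m → flipM s · bar m) (sym (vtx-toℕ i)) (toℕ-inject₁ i) ⟩
    Π (suc i)
      ≡⟨ cong Π (σ-inject₁ i) ⟨
    Π (σ i (inject₁ i))
      ∎
  ... | no _ | yes refl = begin
    flipM (inject₁ i) · (flipM (vtx (toℕ i)) · bar (toℕ i))
      ≡⟨ cong (λ s → flipM (inject₁ i) · (flipM s · bar (toℕ i))) (vtx-toℕ i) ⟩
    flipM (inject₁ i) · (flipM (inject₁ i) · bar (toℕ i))
      ≡⟨ flip-involutive (inject₁ i) (bar (toℕ i)) ⟩
    bar (toℕ i)
      ≡⟨ cong bar (toℕ-inject₁ i) ⟨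
    Π (inject₁ i)
      ≡⟨ cong Π (σ-suc i) ⟨
    Π (σ i (suc i))
      ∎
  ... | no j≢i | no j≢i+1 = begin
    gen i · Π j   ≡⟨ flip-fixes (inject₁ i) (Π j) Πⱼ-vanishes-at-sᵢ ⟩
    Π j           ≡⟨ cong Π (σ-fixes i j j≢i j≢i+1) ⟨
    Π (σ i j)     ∎
    where
    Πⱼ-vanishes-at-sᵢ : lookup (Π j) (inject₁ i) ≡ false
    Πⱼ-vanishes-at-sᵢ = trans (lookup-Π-path j i)
      (cong₂ _xor_ (dec-false (j ≟ inject₁ i) j≢i) (dec-false (j ≟ suc i) j≢i+1))

  gen-s̃ₙ : ∀ i → gen i · chr sn ≡ chr sn
  gen-s̃ₙ i = flip-fixes (inject₁ i) (chr sn) (lookup-s̃ₙ-path i)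

  -- Coordinates with respect to Δ

  comb : Vec Bool n → Bool → F2^ n
  comb x ε = lincomb x Π ⊕ (if ε then chr sn else zeroV)

  gen-comb : ∀ i x ε → gen i · comb x ε ≡ comb (swapAt i x) ε
  gen-comb i x ε = begin
    gen i · (lincomb x Π ⊕ εs̃ₙ)              ≡⟨ ·-⊕ (gen i) (lincomb x Π) εs̃ₙ ⟩
    (gen i · lincomb x Π) ⊕ (gen i · εs̃ₙ)    ≡⟨ cong₂ _⊕_ (·-lincomb (gen i) x Π) (gen-εs̃ₙ ε) ⟩
    lincomb x (λ j → gen i · Π j) ⊕ εs̃ₙ      ≡⟨ cong (_⊕ εs̃ₙ) (lincomb-cong x (gen-Π i)) ⟩
    lincomb x (λ j → Π (σ i j)) ⊕ εs̃ₙ        ≡⟨ cong (_⊕ εs̃ₙ) (lincomb-σ i x Π) ⟩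
    lincomb (swapAt i x) Π ⊕ εs̃ₙ             ∎
    where
    εs̃ₙ = if ε then chr sn else zeroV
    gen-εs̃ₙ : ∀ ε → gen i · (if ε then chr sn else zeroV) ≡ (if ε then chr sn else zeroV)
    gen-εs̃ₙ true  = gen-s̃ₙ i
    gen-εs̃ₙ false = ·-zeroV (gen i)

  act-comb : ∀ g x ε → act g (comb x ε) ≡ comb (swaps g x) ε
  act-comb []      x ε = refl
  act-comb (i ∷ g) x ε = trans (cong (gen i ·_) (act-comb g x ε)) (gen-comb i (swaps g x) ε)

  lookup-comb-path : ∀ x ε (i : Fin k) → lookup (comb x ε) (inject₁ i) ≡ lookup (∂ x) i
  lookup-comb-path x ε i = begin
    lookup (comb x ε) (inject₁ i)
      ≡⟨ lookup-⊕ (lincomb x Π) _ (inject₁ i) ⟩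
    lookup (lincomb x Π) (inject₁ i) xor lookup (if ε then chr sn else zeroV) (inject₁ i)
      ≡⟨ cong₂ _xor_ (lookup-lincomb x Π (inject₁ i)) εs̃ₙ-vanishes ⟩
    ∑[ j < n ] (lookup x j ∧ lookup (Π j) (inject₁ i)) xor false
      ≡⟨ xor-identityʳ _ ⟩
    ∑[ j < n ] (lookup x j ∧ lookup (Π j) (inject₁ i))
      ≡⟨ sum-cong-≗ (λ j → trans (cong (lookup x j ∧_) (lookup-Π-path j i))
                                 (∧-distribˡ-xor (lookup x j) (does (j ≟ inject₁ i)) (does (j ≟ suc i)))) ⟩
    ∑[ j < n ] ((lookup x j ∧ does (j ≟ inject₁ i)) xor (lookup x j ∧ does (j ≟ suc i)))
      ≡⟨ ∑-distrib-+ (λ j → lookup x j ∧ does (j ≟ inject₁ i)) (λ j → lookup x j ∧ does (j ≟ suc i)) ⟩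
    ∑[ j < n ] (lookup x j ∧ does (j ≟ inject₁ i)) xor ∑[ j < n ] (lookup x j ∧ does (j ≟ suc i))
      ≡⟨ cong₂ _xor_ (pick (inject₁ i)) (pick (suc i)) ⟩
    lookup x (inject₁ i) xor lookup x (suc i)
      ≡⟨ lookup-∂ x i ⟨
    lookup (∂ x) i
      ∎
    where
    εs̃ₙ-vanishes : lookup (if ε then chr sn else zeroV) (inject₁ i) ≡ false
    εs̃ₙ-vanishes = trans (lookup-if-zeroV ε (chr sn) (inject₁ i))
                         (trans (cong (ε ∧_) (lookup-s̃ₙ-path i)) (∧-zeroʳ ε))
    pick : ∀ a → ∑[ j < n ] (lookup x j ∧ does (j ≟ a)) ≡ lookup x a
    pick a = trans (sum-cong-≗ (λ j → ∧-comm (lookup x j) (does (j ≟ a)))) (sum-δ a (lookup x))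

  lookup-comb-sn : ∀ x ε → lookup (comb x ε) sn ≡ lookup (lincomb x Π) sn xor ε
  lookup-comb-sn x ε = begin
    lookup (comb x ε) sn
      ≡⟨ lookup-⊕ (lincomb x Π) _ sn ⟩
    lookup (lincomb x Π) sn xor lookup (if ε then chr sn else zeroV) sn
      ≡⟨ cong (lookup (lincomb x Π) sn xor_) (lookup-if-zeroV ε (chr sn) sn) ⟩
    lookup (lincomb x Π) sn xor (ε ∧ lookup (chr sn) sn)
      ≡⟨ cong (λ q → lookup (lincomb x Π) sn xor (ε ∧ q))
              (trans (lookup-chr sn sn) (dec-true (sn ≟ sn) refl)) ⟩
    lookup (lincomb x Π) sn xor (ε ∧ true)
      ≡⟨ cong (lookup (lincomb x Π) sn xor_) (∧-identityʳ ε) ⟩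
    lookup (lincomb x Π) sn xor ε
      ∎

  Δ-inject₁ : ∀ i → Δ (inject₁ i) ≡ Π (inject₁ i)
  Δ-inject₁ i with toℕ (inject₁ i) <? k
  ... | yes _  = refl
  ... | no i≮k = ⊥-elim (i≮k (inject₁<k i))

  Δ-fromℕ : Δ (fromℕ k) ≡ chr sn
  Δ-fromℕ with toℕ (fromℕ k) <? k
  ... | yes k<k = ⊥-elim (<-irrefl (toℕ-fromℕ k) k<k)
  ... | no _    = refl

  lincomb-Δ : ∀ ys e → lincomb (ys ∷ʳ e) Δ ≡ comb (ys ∷ʳ false) e
  lincomb-Δ ys e = ≡-by-lookup coordinate
    where
    coordinate : ∀ t → lookup (lincomb (ys ∷ʳ e) Δ) t ≡ lookup (comb (ys ∷ʳ false) e) t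
    coordinate t = begin
      lookup (lincomb (ys ∷ʳ e) Δ) t
        ≡⟨ lookup-lincomb-∷ʳ ys e Δ t ⟩
      ∑[ i < k ] (lookup ys i ∧ lookup (Δ (inject₁ i)) t) xor (e ∧ lookup (Δ (fromℕ k)) t)
        ≡⟨ cong₂ _xor_ (sum-cong-≗ (λ i → cong (λ u → lookup ys i ∧ lookup u t) (Δ-inject₁ i)))
                       (cong (λ u → e ∧ lookup u t) Δ-fromℕ) ⟩
      Σys xor (e ∧ lookup (chr sn) t)
        ≡⟨ cong (_xor (e ∧ lookup (chr sn) t)) (trans (lookup-lincomb-∷ʳ ys false Π t) (xor-identityʳ Σys)) ⟨
      lookup (lincomb (ys ∷ʳ false) Π) t xor (e ∧ lookup (chr sn) t)
        ≡⟨ cong (lookup (lincomb (ys ∷ʳ false) Π) t xor_) (lookup-if-zeroV e (chr sn) t) ⟨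
      lookup (lincomb (ys ∷ʳ false) Π) t xor lookup (if e then chr sn else zeroV) t
        ≡⟨ lookup-⊕ (lincomb (ys ∷ʳ false) Π) _ t ⟨
      lookup (comb (ys ∷ʳ false) e) t
        ∎
      where
      Σys = ∑[ i < k ] (lookup ys i ∧ lookup (Π (inject₁ i)) t)

  encode : Vec Bool k × Bool → F2^ n
  encode (y , ε) = comb (y ∷ʳ false) ε

  path-part : F2^ n → Vec Bool k
  path-part v = tabulate (λ i → lookup v (inject₁ i))

  -- On the path comb x ε is ∂ x, so the coefficients are recovered by ∫; ε is then read off at sₙ.
  decode : F2^ n → Vec Bool k × Bool
  decode v = ∫ (path-part v) , lookup v sn xor lookup (lincomb (∫ (path-part v) ∷ʳ false) Π) sn

  encode-decode : ∀ v → encode (decode v) ≡ v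
  encode-decode v = ≡-by-lookup coordinate
    where
    y = proj₁ (decode v)
    c = lookup (lincomb (y ∷ʳ false) Π) sn
    coordinate : ∀ t → lookup (encode (decode v)) t ≡ lookup v t
    coordinate t with view t
    ... | ‵fromℕ = begin
      lookup (encode (decode v)) sn             ≡⟨ lookup-comb-sn (y ∷ʳ false) (proj₂ (decode v)) ⟩
      c xor (lookup v sn xor c)                 ≡⟨ cong (c xor_) (xor-comm (lookup v sn) c) ⟩
      c xor (c xor lookup v sn)                 ≡⟨ xor-assoc c c (lookup v sn) ⟨
      (c xor c) xor lookup v sn                 ≡⟨ cong (_xor lookup v sn) (xor-same c) ⟩
      lookup v sn                               ∎
    ... | ‵inject₁ i = begin
      lookup (encode (decode v)) (inject₁ i)    ≡⟨ lookup-comb-path (y ∷ʳ false) (proj₂ (decode v)) i ⟩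
      lookup (∂ (∫ (path-part v) ∷ʳ false)) i   ≡⟨ cong (λ z → lookup z i) (∂-∫ (path-part v)) ⟩
      lookup (path-part v) i                    ≡⟨ lookup∘tabulate _ i ⟩
      lookup v (inject₁ i)                      ∎

  decode-encode : ∀ p → decode (encode p) ≡ p
  decode-encode (y , ε) = cong₂ _,_ path-coefficients (begin
    lookup (encode (y , ε)) sn xor lookup (lincomb (∫ (path-part (encode (y , ε))) ∷ʳ false) Π) sn
      ≡⟨ cong (λ z → lookup (encode (y , ε)) sn xor lookup (lincomb (z ∷ʳ false) Π) sn) path-coefficients ⟩
    lookup (encode (y , ε)) sn xor c
      ≡⟨ cong (_xor c) (trans (lookup-comb-sn (y ∷ʳ false) ε) (xor-comm c ε)) ⟩
    (ε xor c) xor c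
      ≡⟨ xor-cancelʳ ε c ⟩
    ε
      ∎)
    where
    c = lookup (lincomb (y ∷ʳ false) Π) sn
    path-coefficients : ∫ (path-part (encode (y , ε))) ≡ y
    path-coefficients = begin
      ∫ (path-part (encode (y , ε)))
        ≡⟨ cong ∫ (≡-by-lookup λ i → trans (lookup∘tabulate _ i) (lookup-comb-path (y ∷ʳ false) ε i)) ⟩
      ∫ (∂ (y ∷ʳ false))
        ≡⟨ ∫-∂ y ⟩
      y ∎

  decode-unique : ∀ {v} p → v ≡ encode p → decode v ≡ p
  decode-unique p refl = decode-encode p

  decode-zero : ∀ v → proj₂ (decode v) ≡ false → weight (proj₁ (decode v)) ≡ 0 → v ≡ zeroV
  decode-zero v ε≡0 y≡0 = begin
    v
      ≡⟨ encode-decode v ⟨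
    encode (decode v)
      ≡⟨ cong (λ ε → encode (y , ε)) ε≡0 ⟩
    comb (y ∷ʳ false) false
      ≡⟨ cong (λ x → comb x false) (weight≡0⇒replicate (y ∷ʳ false) (trans (weight-∷ʳ-false y) y≡0)) ⟩
    comb (replicate n false) false
      ≡⟨ ⊕-identityʳ (lincomb (replicate n false) Π) ⟩
    lincomb (replicate n false) Π
      ≡⟨ lincomb-replicate-false n Π ⟩
    zeroV
      ∎
    where y = proj₁ (decode v)

  weight-decode<n : ∀ v → weight (proj₁ (decode v)) < n
  weight-decode<n v = s≤s (weight≤length (proj₁ (decode v)))

  sw : F2^ n → ℕ
  sw v = weight (proj₁ (decode v) ∷ʳ proj₂ (decode v))

  SW⇔≡sw : ∀ v w → SW v w ⇔ w ≡ sw v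
  SW⇔≡sw v w = mk⇔ to from
    where
    to : SW v w → w ≡ sw v
    to (c , v≡Δc , wc≡w) with initLast c
    ... | ys , e , refl = begin
      w                  ≡⟨ wc≡w ⟨
      weight (ys ∷ʳ e)   ≡⟨ cong (λ p → weight (proj₁ p ∷ʳ proj₂ p)) decode-v ⟨
      sw v               ∎
      where
      decode-v : decode v ≡ (ys , e)
      decode-v = decode-unique (ys , e) (trans v≡Δc (lincomb-Δ ys e))
    from : w ≡ sw v → SW v w
    from refl = proj₁ (decode v) ∷ʳ proj₂ (decode v)
              , sym (trans (lincomb-Δ (proj₁ (decode v)) (proj₂ (decode v))) (encode-decode v))
              , refl

  ∃SW⇔ : ∀ v (P : ℕ → Set) → (Σ ℕ λ w → SW v w × P w) ⇔ P (sw v)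
  ∃SW⇔ v P = mk⇔ (λ (w , v-has-w , Pw) → subst P (Equivalence.to (SW⇔≡sw v w) v-has-w) Pw)
                 (λ P-sw → sw v , Equivalence.from (SW⇔≡sw v (sw v)) refl , P-sw)

  sw-decode : ∀ v {ε} → proj₂ (decode v) ≡ ε → sw v ≡ weight (proj₁ (decode v) ∷ʳ ε)
  sw-decode v refl = refl

  IsOrbit-⇔ : ∀ {X Y : F2^ n → Set} → (∀ v → X v ⇔ Y v) → IsOrbit Y → IsOrbit X
  IsOrbit-⇔ X⇔Y (w , Y⇔orbit) = w , λ v → ⇔.trans (X⇔Y v) (Y⇔orbit v)

  module EvenParity (even : card-Π₁ % 2 ≡ 0) where

    sum-Π : ∀ t → ∑[ j < n ] lookup (Π j) t ≡ false
    sum-Π t with view t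
    ... | ‵fromℕ = begin
      ∑[ j < n ] lookup (bar (toℕ j)) sn    ≡⟨ sum-cong-≗ {n} (λ j → ⟨⟩-chr (bar (toℕ j)) sn) ⟨
      ∑[ j < n ] ⟨ bar (toℕ j) , chr sn ⟩   ≡⟨ sum≡parity-count n (λ m → m) (λ m → ⟨ bar m , chr sn ⟩) ⟩
      parity card-Π₁                       ≡⟨ parity-even card-Π₁ even ⟩
      false                                ∎
    ... | ‵inject₁ i = begin
      ∑[ j < n ] lookup (Π j) (inject₁ i)
        ≡⟨ sum-cong-≗ (λ j → lookup-Π-path j i) ⟩
      ∑[ j < n ] (does (j ≟ inject₁ i) xor does (j ≟ suc i))
        ≡⟨ ∑-distrib-+ (λ j → does (j ≟ inject₁ i)) (λ j → does (j ≟ suc i)) ⟩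
      ∑[ j < n ] does (j ≟ inject₁ i) xor ∑[ j < n ] does (j ≟ suc i)
        ≡⟨ cong₂ _xor_ (count-one (inject₁ i)) (count-one (suc i)) ⟩
      false
        ∎
      where
      count-one : ∀ a → ∑[ j < n ] does (j ≟ a) ≡ true
      count-one a = trans (sum-cong-≗ (λ j → sym (∧-identityʳ (does (j ≟ a))))) (sum-δ a (λ _ → true))

    comb-map-not : ∀ x ε → comb (map not x) ε ≡ comb x ε
    comb-map-not x ε = cong (_⊕ (if ε then chr sn else zeroV)) (lincomb-map-not x Π sum-Π)

    normalise : ∀ x ε →
      Σ (Vec Bool k) λ y → comb x ε ≡ encode (y , ε) × (weight y ≡ weight x ⊎ weight y ≡ n ∸ weight x)
    normalise x ε with initLast x
    ... | y , false , refl = y , refl , inj₁ (sym (weight-∷ʳ-false y))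
    ... | y , true  , refl = map not y , complement , inj₂ (begin
      weight (map not y)        ≡⟨ weight-map-not y ⟩
      k ∸ weight y              ≡⟨ cong (n ∸_) (weight-∷ʳ-true y) ⟨
      n ∸ weight (y ∷ʳ true)    ∎)
      where
      complement : comb (y ∷ʳ true) ε ≡ encode (map not y , ε)
      complement = trans (sym (comb-map-not (y ∷ʳ true) ε)) (cong (λ z → comb z ε) (map-∷ʳ not true y))

    InU⇔ : ∀ v → InU v ⇔ proj₂ (decode v) ≡ false
    InU⇔ v = mk⇔ to from
      where
      to : InU v → proj₂ (decode v) ≡ false
      to (c , refl) with normalise c false
      ... | y , c≡y , _ = cong proj₂ (decode-unique (y , false) (trans (sym (⊕-identityʳ (lincomb c Π))) c≡y))
      from : proj₂ (decode v) ≡ false → InU v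
      from ε≡false = y ∷ʳ false , (begin
        v                              ≡⟨ encode-decode v ⟨
        encode (decode v)              ≡⟨ cong (λ ε → encode (y , ε)) ε≡false ⟩
        lincomb (y ∷ʳ false) Π ⊕ zeroV ≡⟨ ⊕-identityʳ (lincomb (y ∷ʳ false) Π) ⟩
        lincomb (y ∷ʳ false) Π         ∎)
        where y = proj₁ (decode v)

    ¬InU⇔ : ∀ v → (¬ InU v) ⇔ proj₂ (decode v) ≡ true
    ¬InU⇔ v = mk⇔ (λ ¬inU → ¬-not (¬inU ∘ Equivalence.from (InU⇔ v)))
                  (λ ε≡true → not-¬ ε≡true ∘ Equivalence.to (InU⇔ v))

    InWeightClass : Bool → ℕ → Vec Bool k × Bool → Set
    InWeightClass ε i (y , ε′) = ε′ ≡ ε × (weight y ≡ i ⊎ weight y ≡ n ∸ i)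

    WeightClass : Bool → ℕ → F2^ n → Set
    WeightClass ε i v = InWeightClass ε i (decode v)

    comb∈WeightClass : ∀ x ε → WeightClass ε (weight x) (comb x ε)
    comb∈WeightClass x ε with normalise x ε
    ... | y , x≡y , y∼x = subst (InWeightClass ε (weight x)) (sym (decode-unique (y , ε) x≡y)) (refl , y∼x)

    WeightClass⇒comb : ∀ {ε i v} → i ≤ n → WeightClass ε i v →
      Σ (Vec Bool n) λ x → weight x ≡ i × comb x ε ≡ v
    WeightClass⇒comb {v = v} _ (refl , inj₁ wy≡i) =
      proj₁ (decode v) ∷ʳ false , trans (weight-∷ʳ-false (proj₁ (decode v))) wy≡i , encode-decode v
    WeightClass⇒comb {i = i} {v} i≤n (refl , inj₂ wy≡n∸i) =
      map not x , weight-complement , trans (comb-map-not x (proj₂ (decode v))) (encode-decode v)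
      where
      x = proj₁ (decode v) ∷ʳ false
      weight-complement : weight (map not x) ≡ i
      weight-complement = begin
        weight (map not x)   ≡⟨ weight-map-not x ⟩
        n ∸ weight x         ≡⟨ cong (n ∸_) (trans (weight-∷ʳ-false (proj₁ (decode v))) wy≡n∸i) ⟩
        n ∸ (n ∸ i)          ≡⟨ m∸[m∸n]≡n i≤n ⟩
        i                    ∎

    comb-reachable : ∀ x ε → InOrbit (comb (ones n (weight x)) ε) (comb x ε)
    comb-reachable x ε with ones↝ x
    ... | g , ones↝x = g , (begin
      comb x ε                              ≡⟨ cong (λ z → comb z ε) ones↝x ⟨
      comb (swaps g (ones n (weight x))) ε  ≡⟨ act-comb g (ones n (weight x)) ε ⟨
      act g (comb (ones n (weight x)) ε)    ∎)

    WeightClass-isOrbit : ∀ ε i → i ≤ n → IsOrbit (WeightClass ε i)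
    WeightClass-isOrbit ε i i≤n = comb (ones n i) ε , λ v → mk⇔ (to v) (from v)
      where
      to : ∀ v → WeightClass ε i v → InOrbit (comb (ones n i) ε) v
      to v s with WeightClass⇒comb i≤n s
      ... | x , refl , x≡v = subst (InOrbit (comb (ones n (weight x)) ε)) x≡v (comb-reachable x ε)
      from : ∀ v → InOrbit (comb (ones n i) ε) v → WeightClass ε i v
      from v (g , refl) =
        subst₂ (WeightClass ε) weight-x≡i (sym (act-comb g (ones n i) ε)) (comb∈WeightClass x ε)
        where
        x = swaps g (ones n i)
        weight-x≡i : weight x ≡ i
        weight-x≡i = trans (weight-swaps g (ones n i)) (weight-ones i≤n)

    U-T⇔WeightClass : ∀ i v → U-T i (n ∸ i) v ⇔ WeightClass false i v
    U-T⇔WeightClass i v = mk⇔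
      (λ (inU , s) → let ε≡false = Equivalence.to (InU⇔ v) inU in
        ε≡false , subst Has (sw≡ ε≡false) (Equivalence.to (∃SW⇔ v Has) s))
      (λ (ε≡false , h) → Equivalence.from (InU⇔ v) ε≡false ,
        Equivalence.from (∃SW⇔ v Has) (subst Has (sym (sw≡ ε≡false)) h))
      where
      Has : ℕ → Set
      Has m = m ≡ i ⊎ m ≡ n ∸ i
      sw≡ : proj₂ (decode v) ≡ false → sw v ≡ weight (proj₁ (decode v))
      sw≡ ε≡false = trans (sw-decode v ε≡false) (weight-∷ʳ-false (proj₁ (decode v)))

    Ubar-T⇔WeightClass : ∀ i v → i ≤ n → Ubar-T (suc i) (suc n ∸ i) v ⇔ WeightClass true i v
    Ubar-T⇔WeightClass i v i≤n = mk⇔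
      (λ (¬inU , s) → let ε≡true = Equivalence.to (¬InU⇔ v) ¬inU in
        ε≡true , pred-Has (subst Has (sw≡ ε≡true) (Equivalence.to (∃SW⇔ v Has) s)))
      (λ (ε≡true , h) → Equivalence.from (¬InU⇔ v) ε≡true ,
        Equivalence.from (∃SW⇔ v Has) (subst Has (sym (sw≡ ε≡true)) (suc-Has h)))
      where
      Has : ℕ → Set
      Has m = m ≡ suc i ⊎ m ≡ suc n ∸ i
      n+1∸i : suc n ∸ i ≡ suc (n ∸ i)
      n+1∸i = +-∸-assoc 1 i≤n
      pred-Has : ∀ {w} → Has (suc w) → w ≡ i ⊎ w ≡ n ∸ i
      pred-Has = Sum.map suc-injective (λ p → suc-injective (trans p n+1∸i))
      suc-Has : ∀ {w} → w ≡ i ⊎ w ≡ n ∸ i → Has (suc w)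
      suc-Has = Sum.map (cong suc) (λ p → trans (cong suc p) (sym n+1∸i))
      sw≡ : proj₂ (decode v) ≡ true → sw v ≡ suc (weight (proj₁ (decode v)))
      sw≡ ε≡true = trans (sw-decode v ε≡true) (weight-∷ʳ-true (proj₁ (decode v)))

    Ubar-T-1⇔WeightClass : ∀ v → Ubar-T 1 1 v ⇔ WeightClass true 0 v
    Ubar-T-1⇔WeightClass v = mk⇔
      (λ (¬inU , s) → let ε≡true = Equivalence.to (¬InU⇔ v) ¬inU in
        ε≡true ,
        inj₁ (suc-injective (trans (sym (sw≡ ε≡true)) (Sum.[ id , id ] (Equivalence.to (∃SW⇔ v Has) s)))))
      (λ (ε≡true , h) → Equivalence.from (¬InU⇔ v) ε≡true ,
        Equivalence.from (∃SW⇔ v Has) (inj₁ (trans (sw≡ ε≡true) (cong suc (weight≡0 h)))))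
      where
      Has : ℕ → Set
      Has m = m ≡ 1 ⊎ m ≡ 1
      sw≡ : proj₂ (decode v) ≡ true → sw v ≡ suc (weight (proj₁ (decode v)))
      sw≡ ε≡true = trans (sw-decode v ε≡true) (weight-∷ʳ-true (proj₁ (decode v)))
      weight≡0 : weight (proj₁ (decode v)) ≡ 0 ⊎ weight (proj₁ (decode v)) ≡ n → weight (proj₁ (decode v)) ≡ 0
      weight≡0 (inj₁ w≡0) = w≡0
      weight≡0 (inj₂ w≡n) = ⊥-elim (<-irrefl w≡n (weight-decode<n v))

    i≤n/2⇒i≤n : ∀ {i} → i ≤ n / 2 → i ≤ n
    i≤n/2⇒i≤n i≤n/2 = ≤-trans i≤n/2 (m/n≤m n 2)

    listed-orbit : ∀ X → Listed X → IsOrbit X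
    listed-orbit _ ubar1 =
      IsOrbit-⇔ Ubar-T-1⇔WeightClass (WeightClass-isOrbit true 0 z≤n)
    listed-orbit _ (ubari i _ i≤n/2) =
      IsOrbit-⇔ (λ v → Ubar-T⇔WeightClass i v (i≤n/2⇒i≤n i≤n/2))
                (WeightClass-isOrbit true i (i≤n/2⇒i≤n i≤n/2))
    listed-orbit _ (ui i _ i≤n/2) =
      IsOrbit-⇔ (U-T⇔WeightClass i) (WeightClass-isOrbit false i (i≤n/2⇒i≤n i≤n/2))

    listed-cover : ∀ v → v ≢ zeroV → Σ (F2^ n → Set) λ X → Listed X × X v
    listed-cover v v≢0 with proj₂ (decode v) in ε≡ | weight (proj₁ (decode v)) in w≡
    ... | false | zero  = ⊥-elim (v≢0 (decode-zero v ε≡ w≡))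
    ... | true  | zero  = Ubar-T 1 1 , ubar1 , Equivalence.from (Ubar-T-1⇔WeightClass v) (ε≡ , inj₁ w≡)
    ... | false | suc m with fold-to-half (s≤s z≤n) (subst (_< n) w≡ (weight-decode<n v))
    ...   | i , 1≤i , i≤n/2 , m∈ =
      U-T i (n ∸ i) , ui i 1≤i i≤n/2 ,
      Equivalence.from (U-T⇔WeightClass i v) (ε≡ , subst (λ w → w ≡ i ⊎ w ≡ n ∸ i) (sym w≡) m∈)
    listed-cover v v≢0 | true | suc m with fold-to-half (s≤s z≤n) (subst (_< n) w≡ (weight-decode<n v))
    ...   | i , 1≤i , i≤n/2 , m∈ =
      Ubar-T (suc i) (suc n ∸ i) , ubari i 1≤i i≤n/2 ,
      Equivalence.from (Ubar-T⇔WeightClass i v (i≤n/2⇒i≤n i≤n/2))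
                       (ε≡ , subst (λ w → w ≡ i ⊎ w ≡ n ∸ i) (sym w≡) m∈)

lemma6p2 : (k : ℕ) (adj : Fin (suc k) → Fin (suc k) → Bool) →
    1 ≤ k → Symmetric adj → Loopless adj → InducedPath k adj → Connected adj →
    Setting.card-Π₁ k adj % 2 ≡ 0 →
    ((X : F2^ (suc k) → Set) → Setting.Listed k adj X → Setting.IsOrbit k adj X)
    × ((v : F2^ (suc k)) → v ≢ zeroV →
       Σ (F2^ (suc k) → Set) λ X → Setting.Listed k adj X × X v)
lemma6p2 k adj _ _ loopless path _ even = listed-orbit , listed-cover
  where open PathFlips.EvenParity k adj loopless path even
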